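{- Let $G$ be a graph and let $h,t,p$ be integers with $t\geq p\geq 2$ and $h\geq t$. Let $T$ be a vertex-labeled tree with $t$ edges and $p$ leaves. Let $\mathcal F$ be a collection of copies of $T$ in $G$ such that every member is $h$-admissible in $\mathcal F$ and all members share the same leaf vector $\langle y_1,\dots,y_p\rangle$. If $|\mathcal F|\geq \frac12 h^{t^2}$, then $\langle y_1,\dots,y_p\rangle$ is $(T,h)$-linked in $\mathcal F$.
   Context: A vertex-labeled tree $T$ has vertices labeled $1,\dots,v(T)$; its leaf vector lists its leaves in increasing label order. A copy of $T$ in $G$ is an injective edge-preserving map $\phi:V(T)\to V(G)$; its leaf vector is the image of the leaf vector of $T$; for a subtree $D$ of $T$, $F[D]$ is the restriction of $F$ to $D$, and $\mathcal F[D]=\{F[D]:F\in\mathcal F\}$. For a family $\mathcal F'$ of copies of a tree $T'$, a member is $h$-heavy in $\mathcal F'$ if at least $h^{e(T')^2}$ members of $\mathcal F'$ share its leaf vector, and $h$-light otherwise. For a non-leaf $v$ of $T$ of degree $d$, the subtrees split by $v$ are the $d$ edge-disjoint subtrees of $T$, each having $v$ as a leaf, whose union is $T$. $F\in\mathcal F$ is $h$-admissible in $\mathcal F$ if $T$ is a single edge or, for every non-leaf $v$ of $T$ and every subtree $D$ split by $v$, $F[D]$ is $h$-light in $\mathcal F[D]$. A tuple $\langle y_1,\dots,y_p\rangle$ is $(T,h)$-linked in $\mathcal F$ if there are $h$ members of $\mathcal F$ with leaf vector $\langle y_1,\dots,y_p\rangle$ that are pairwise vertex-disjoint apart from $\{y_1,\dots,y_p\}$.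 -}

module Defs where

open import Data.Nat using (ℕ; zero; suc; _+_; _*_; _∸_; _^_; _≤_; _≡ᵇ_; _<ᵇ_)
open import Data.Bool using (Bool; true; false; _∧_; _∨_; not; if_then_else_)
open import Data.Fin using (Fin; toℕ)
open import Data.List using (List; []; _∷_; length; map; allFin; filterᵇ)
open import Data.Nat.ListAction using (sum)
open import Data.Bool.ListAction using (any)
open import Data.List.Membership.Propositional using (_∈_)
open import Data.List.Relation.Unary.All using (All)
open import Data.List.Relation.Unary.AllPairs using (AllPairs)
open import Data.Vec using (Vec; lookup)
open import Data.Product using (Σ; _×_)
open import Data.Sum using (_⊎_)
open import Relation.Nullary using (¬_)
open import Relation.Binary.PropositionalEquality using (_≡_; _≢_)

record Graph (n : ℕ) : Set₁ where
  field
    Adj   : Fin n → Fin n → Set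
    sym   : ∀ {x y} → Adj x y → Adj y x
    irrfl : ∀ {x} → ¬ Adj x x
open Graph public

_==_ : ∀ {k} → Fin k → Fin k → Bool
i == j = toℕ i ≡ᵇ toℕ j

Subset : ℕ → Set
Subset k = Fin k → Bool

full : ∀ {k} → Subset k
full _ = true

edgesIn : ∀ {k} → (Fin k → Fin k → Bool) → Subset k → ℕ
edgesIn {k} adj S =
  sum (map (λ i → sum (map (λ j →
    if (toℕ i <ᵇ toℕ j) ∧ S i ∧ S j ∧ adj i j then 1 else 0) (allFin k))) (allFin k))

degIn : ∀ {k} → (Fin k → Fin k → Bool) → Subset k → Fin k → ℕ
degIn {k} adj S v = sum (map (λ u → if S u ∧ adj v u then 1 else 0) (allFin k))

-- leaf vector of the subgraph induced by S: its leaves (degree 1 in S),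
-- listed in increasing label order
leavesIn : ∀ {k} → (Fin k → Fin k → Bool) → Subset k → List (Fin k)
leavesIn {k} adj S = filterᵇ (λ v → S v ∧ (degIn adj S v ≡ᵇ 1)) (allFin k)

data Walk {k : ℕ} (adj : Fin k → Fin k → Bool) : Fin k → Fin k → Set where
  here : ∀ {i} → Walk adj i i
  step : ∀ {i j l} → adj i j ≡ true → Walk adj j l → Walk adj i l

-- Vertex-labeled trees: vertex i : Fin size has label toℕ i + 1.
-- A tree = connected simple graph with (#vertices - 1) edges.

record LTree : Set where
  field
    size      : ℕ
    adj       : Fin size → Fin size → Bool
    adj-sym   : ∀ i j → adj i j ≡ adj j i
    adj-irr   : ∀ i → adj i i ≡ false
    connected : ∀ i j → Walk adj i j
    edgeCount : edgesIn adj full ≡ size ∸ 1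
open LTree public

e : LTree → ℕ
e T = edgesIn (adj T) full

deg : (T : LTree) → Fin (size T) → ℕ
deg T = degIn (adj T) full

leafVec : (T : LTree) → List (Fin (size T))
leafVec T = leavesIn (adj T) full

numLeaves : LTree → ℕ
numLeaves T = length (leafVec T)

-- Subtrees split by a vertex v: for each neighbour u of v, the subtree
-- consisting of v together with the component of T - v containing u.

reachStep : (T : LTree) → Fin (size T) → Subset (size T) → Subset (size T)
reachStep T v R w = R w ∨ (not (w == v) ∧ any (λ x → R x ∧ adj T x w) (allFin (size T)))

iter : ∀ {A : Set} → ℕ → (A → A) → A → A
iter zero    f a = a
iter (suc m) f a = f (iter m f a)

-- component of T - v containing u (size T BFS rounds suffice)
compAvoid : (T : LTree) → Fin (size T) → Fin (size T) → Subset (size T)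
compAvoid T v u = iter (size T) (reachStep T v) (λ w → w == u)

split : (T : LTree) → Fin (size T) → Fin (size T) → Subset (size T)
split T v u w = (w == v) ∨ compAvoid T v u w

Map : LTree → ℕ → Set
Map T n = Vec (Fin n) (size T)

record IsCopy (T : LTree) {n : ℕ} (G : Graph n) (φ : Map T n) : Set where
  field
    injective : ∀ i j → lookup φ i ≡ lookup φ j → i ≡ j
    edgePres  : ∀ i j → adj T i j ≡ true → Adj G (lookup φ i) (lookup φ j)

leafVecOf : (T : LTree) {n : ℕ} → Map T n → List (Fin n)
leafVecOf T φ = map (lookup φ) (leafVec T)

SameRestr : (T : LTree) {n : ℕ} → Subset (size T) → Map T n → Map T n → Set
SameRestr T D φ ψ = ∀ w → D w ≡ true → lookup φ w ≡ lookup ψ w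

SameLeafVecIn : (T : LTree) {n : ℕ} → Subset (size T) → Map T n → Map T n → Set
SameLeafVecIn T D φ ψ = map (lookup φ) (leavesIn (adj T) D) ≡ map (lookup ψ) (leavesIn (adj T) D)

-- F[D] is h-heavy in 𝓕[D]: at least h^(e(D)^2) distinct members of 𝓕[D]
-- (given by representatives in 𝓕 with pairwise distinct restrictions)
-- share the leaf vector of F[D].
Heavy : (T : LTree) {n : ℕ} → ℕ → List (Map T n) → Subset (size T) → Map T n → Set
Heavy T {n} h 𝓕 D φ =
  Σ (List (Map T n)) λ L →
      (h ^ (edgesIn (adj T) D * edgesIn (adj T) D) ≤ length L)
    × All (_∈ 𝓕) L
    × AllPairs (λ ψ χ → ¬ SameRestr T D ψ χ) L
    × All (SameLeafVecIn T D φ) L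

Light : (T : LTree) {n : ℕ} → ℕ → List (Map T n) → Subset (size T) → Map T n → Set
Light T h 𝓕 D φ = ¬ Heavy T h 𝓕 D φ

Admissible : (T : LTree) {n : ℕ} → ℕ → List (Map T n) → Map T n → Set
Admissible T h 𝓕 φ =
  e T ≡ 1 ⊎
  (∀ v → deg T v ≢ 1 → ∀ u → adj T v u ≡ true → Light T h 𝓕 (split T v u) φ)

Linked : (T : LTree) {n : ℕ} → ℕ → List (Map T n) → List (Fin n) → Set
Linked T {n} h 𝓕 y =
  Σ (List (Map T n)) λ L →
      length L ≡ h
    × All (_∈ 𝓕) L
    × All (λ φ → leafVecOf T φ ≡ y) L
    × AllPairs (λ φ ψ → φ ≢ ψ × (∀ i j → lookup φ i ≡ lookup ψ j → lookup φ i ∈ y)) L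

{-# OPTIONS --safe #-}
-- Let M be a maximal subfamily of 𝓕 whose members are pairwise vertex-disjoint outside y; if
-- |M| ≥ h it witnesses linkedness.  Otherwise every F ∈ 𝓕 meets some F′ ∈ M in a vertex outside
-- y, i.e. F(i) = F′(j) for non-leaves i, j of T, so 𝓕 is covered by at most (h − 1)(t − 1)²
-- fibres {F : F(i) = w} with i a non-leaf.  A non-leaf i splits T into d ≥ 2 subtrees D with
-- Σ e(D) = t whose leaves other than i are leaves of T; on a fibre all restrictions F[D] thus
-- share their leaf vector, and admissibility leaves fewer than h^(e(D)²) distinct ones.  Since F
-- is determined by its restrictions, a fibre has at most ∏ (h^(e(D)²) − 1) < h^((t−1)²+1)
-- members, and then 2|𝓕| < h^(t²).
module Submission where

open import Defs hiding (sym)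
open import Algebra.Properties.CommutativeSemigroup using (interchange)
open import Data.Bool using (Bool; true; false; _∧_; _∨_; not; T; T?; if_then_else_)
open import Data.Bool.ListAction using (any; or)
open import Data.Bool.Properties using (T-≡; ∨-comm; ¬-not; ∧-zeroʳ; ∨-zeroʳ) renaming (_≟_ to _≟ᵇ_)
open import Data.Empty using (⊥-elim)
open import Data.Fin using (Fin; toℕ; zero; suc)
open import Data.Fin.Properties using (toℕ-injective; ¬∀⟶∃¬; all?; any?) renaming (_≟_ to _≟ᶠ_)
open import Data.List using (List; []; _∷_; length; map; filterᵇ; allFin; cartesianProduct; take)
open import Data.List.Membership.Propositional using (_∈_; _∉_; find; lose)
open import Data.List.Membership.Propositional.Properties
  using (∈-allFin; ∈-length; ∈-filter⁺; ∈-filter⁻; ∈-map⁺; ∈-cartesianProduct⁺; ∈-cartesianProduct⁻)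
open import Data.List.Properties
  using (length-take; length-tabulate; length-map; length-++; map-cong; map-cong-local; map-∘; ∷-injective; filter-all)
open import Data.List.Relation.Binary.Subset.Propositional using (_⊆_)
open import Data.List.Relation.Unary.All as All using (All; []; _∷_)
open import Data.List.Relation.Unary.All.Properties as All using (¬All⇒Any¬)
open import Data.List.Relation.Unary.AllPairs using (AllPairs; []; _∷_)
open import Data.List.Relation.Unary.AllPairs.Properties as AllPairs using ()
open import Data.List.Relation.Unary.Any using (here; there)
open import Data.List.Relation.Unary.Any.Properties using (any⁺; any⁻)
open import Data.List.Relation.Unary.Unique.Propositional using (Unique)
open import Data.List.Relation.Unary.Unique.Propositional.Properties using (allFin⁺; filter⁺)
open import Data.Nat
  using (ℕ; NonZero; >-nonZero; zero; suc; _+_; _*_; _^_; _∸_; _≤_; _≥_; _<_; _≤?_; _≡ᵇ_; _<ᵇ_; z≤n; s≤s)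
open import Data.Nat.ListAction using (sum; product)
open import Data.Nat.Properties
  using ( ≤-refl; ≤-reflexive; ≤-trans; ≤-<-trans; <-≤-trans; <-irrefl; <-cmp; ≤-pred; <⇒≱; ≰⇒>; ≤∧≢⇒<
        ; <⇒≤pred; m<n⇒m<1+n; n<1+n; m≤n⇒m≤1+n; m≤m+n; m≤n+m; m≤n⇒m⊓n≡m; ≡ᵇ⇒≡; ≡⇒≡ᵇ; <⇒<ᵇ
        ; +-comm; +-suc; +-commutativeSemigroup; +-mono-≤; +-mono-<-≤; +-mono-≤-<; +-monoˡ-≤; +-monoʳ-≤
        ; *-identityʳ; *-mono-≤; *-monoˡ-≤; *-monoʳ-≤; *-monoˡ-<; m∸n≤m; m∸n+n≡m; ∸-monoˡ-≤
        ; m^n>0; ^-distribˡ-+-*; ^-monoˡ-≤; ^-monoʳ-≤; module ≤-Reasoning )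
open import Data.Nat.Tactic.RingSolver using (solve-∀)
open import Data.Product using (∃; _×_; _,_; proj₁; proj₂; map₁; map₂)
open import Data.Sum as Sum using (_⊎_; inj₁; inj₂)
open import Data.Vec as V using (Vec)
open import Data.Vec.Properties using (tabulate∘lookup; tabulate-cong; ≡-dec)
open import Function using (id; _∘_; case_of_; Equivalence)
open import Relation.Binary.Definitions using (Decidable; tri<; tri≈; tri>)
open import Relation.Binary.PropositionalEquality
  using (_≡_; _≢_; refl; sym; trans; cong; cong₂; subst; subst₂; module ≡-Reasoning)
open import Relation.Binary.Structures using (IsDecEquivalence)
open import Relation.Nullary using (¬_; ¬?; yes; no; does)
open import Relation.Nullary.Decidable using (dec-true; decidable-stable; _→-dec_; _×-dec_)

==⇒≡ : ∀ {k} {i j : Fin k} → (i == j) ≡ true → i ≡ j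
==⇒≡ {i = i} {j} i==j = toℕ-injective (≡ᵇ⇒≡ (toℕ i) (toℕ j) (subst T (sym i==j) _))

==-refl : ∀ {k} (i : Fin k) → (i == i) ≡ true
==-refl i = Equivalence.to T-≡ (≡⇒≡ᵇ (toℕ i) (toℕ i) refl)

≢⇒==-false : ∀ {k} {i j : Fin k} → i ≢ j → (i == j) ≡ false
≢⇒==-false {i = i} {j} i≢j with i == j in eq
... | true  = ⊥-elim (i≢j (==⇒≡ eq))
... | false = refl

not-==⇒≢ : ∀ {k} {i j : Fin k} → not (i == j) ≡ true → i ≢ j
not-==⇒≢ {i = i} i≠i refl with () ← trans (sym i≠i) (cong not (==-refl i))

∨-true⁻ : ∀ {a b} → a ∨ b ≡ true → a ≡ true ⊎ b ≡ true
∨-true⁻ {true}  _ = inj₁ refl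
∨-true⁻ {false} b = inj₂ b

∧-true⁻ : ∀ {a b} → a ∧ b ≡ true → a ≡ true × b ≡ true
∧-true⁻ {true} {true} _ = refl , refl

∧-mono : ∀ {a b c d} → (a ≡ true → c ≡ true) → (b ≡ true → d ≡ true) → a ∧ b ≡ true → c ∧ d ≡ true
∧-mono {true} {true} a⇒c b⇒d _ rewrite a⇒c refl | b⇒d refl = refl

∧-swap : ∀ x y z → x ∧ y ∧ z ≡ y ∧ x ∧ z
∧-swap true  y z = refl
∧-swap false y z = sym (∧-zeroʳ y)

any-true⁻ : ∀ {A : Set} (p : A → Bool) {xs} → any p xs ≡ true → ∃ λ x → x ∈ xs × p x ≡ true
any-true⁻ p {xs} anyp = map₂ (map₂ (Equivalence.to T-≡)) (find (any⁻ p xs (Equivalence.from T-≡ anyp)))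

any-true⁺ : ∀ {A : Set} (p : A → Bool) {xs x} → x ∈ xs → p x ≡ true → any p xs ≡ true
any-true⁺ p x∈xs px = Equivalence.to T-≡ (any⁺ p (lose x∈xs (Equivalence.from T-≡ px)))

𝟙 : Bool → ℕ
𝟙 b = if b then 1 else 0

𝟙≤1 : ∀ b → 𝟙 b ≤ 1
𝟙≤1 true  = s≤s z≤n
𝟙≤1 false = z≤n

𝟙-mono : ∀ {a b} → (a ≡ true → b ≡ true) → 𝟙 a ≤ 𝟙 b
𝟙-mono {false} _   = z≤n
𝟙-mono {true}  a⇒b rewrite a⇒b refl = ≤-refl

𝟙-∨ : ∀ a b → 𝟙 (a ∨ b) ≤ 𝟙 a + 𝟙 b
𝟙-∨ true  _ = s≤s z≤n
𝟙-∨ false _ = ≤-refl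

anotherVertex : ∀ {k} → 2 ≤ k → (i : Fin k) → ∃ λ x → x ≢ i
anotherVertex {suc (suc _)} _ zero    = suc zero , λ ()
anotherVertex {suc (suc _)} _ (suc _) = zero , λ ()
anotherVertex {suc zero} (s≤s ()) _

module _ {A : Set} (p : A → Bool) where

  ∈-filterᵇ⁺ : ∀ {xs x} → x ∈ xs → p x ≡ true → x ∈ filterᵇ p xs
  ∈-filterᵇ⁺ x∈xs px = ∈-filter⁺ (T? ∘ p) x∈xs (Equivalence.from T-≡ px)

  ∈-filterᵇ⁻ : ∀ {xs x} → x ∈ filterᵇ p xs → x ∈ xs × p x ≡ true
  ∈-filterᵇ⁻ x∈ = map₂ (Equivalence.to T-≡) (∈-filter⁻ (T? ∘ p) x∈)

  length-filterᵇ-partition : ∀ xs → length (filterᵇ p xs) + length (filterᵇ (not ∘ p) xs) ≡ length xs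
  length-filterᵇ-partition [] = refl
  length-filterᵇ-partition (x ∷ xs) with p x
  ... | true  = cong suc (length-filterᵇ-partition xs)
  ... | false = trans (+-suc _ _) (cong suc (length-filterᵇ-partition xs))

length-filterᵇ-∷ : ∀ {A : Set} (p : A → Bool) x xs → length (filterᵇ p (x ∷ xs)) ≡ 𝟙 (p x) + length (filterᵇ p xs)
length-filterᵇ-∷ p x xs with p x
... | true  = refl
... | false = refl

Unique∧allEqual⇒length≤1 : ∀ {A : Set} {xs : List A} → Unique xs →
  (∀ {a b} → a ∈ xs → b ∈ xs → a ≡ b) → length xs ≤ 1
Unique∧allEqual⇒length≤1 {xs = []}    _ _ = z≤n
Unique∧allEqual⇒length≤1 {xs = _ ∷ []} _ _ = s≤s z≤n
Unique∧allEqual⇒length≤1 {xs = _ ∷ _ ∷ _} ((a≢b ∷ _) ∷ _) allEqual =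
  ⊥-elim (a≢b (allEqual (here refl) (there (here refl))))

map-≡⇒≡ : ∀ {A B : Set} {f g : A → B} xs → map f xs ≡ map g xs → ∀ {x} → x ∈ xs → f x ≡ g x
map-≡⇒≡ (_ ∷ _)  eq (here refl) = proj₁ (∷-injective eq)
map-≡⇒≡ (_ ∷ xs) eq (there x∈)  = map-≡⇒≡ xs (proj₂ (∷-injective eq)) x∈

length-cartesianProduct : ∀ {A B : Set} (xs : List A) (ys : List B) →
                          length (cartesianProduct xs ys) ≡ length xs * length ys
length-cartesianProduct []       ys = refl
length-cartesianProduct (x ∷ xs) ys = trans (length-++ (map (x ,_) ys))
  (cong₂ _+_ (length-map (x ,_) ys) (length-cartesianProduct xs ys))

lookup-extensionality : ∀ {A : Set} {k} {u v : Vec A k} → (∀ i → V.lookup u i ≡ V.lookup v i) → u ≡ v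
lookup-extensionality {u = u} {v} u≗v = trans (sym (tabulate∘lookup u)) (trans (tabulate-cong u≗v) (tabulate∘lookup v))

∑ : ∀ {A : Set} → List A → (A → ℕ) → ℕ
∑ xs f = sum (map f xs)

module _ {A : Set} where

  ∑-mono-≤ : ∀ xs {f g : A → ℕ} → (∀ {x} → x ∈ xs → f x ≤ g x) → ∑ xs f ≤ ∑ xs g
  ∑-mono-≤ []       _   = z≤n
  ∑-mono-≤ (x ∷ xs) f≤g = +-mono-≤ (f≤g (here refl)) (∑-mono-≤ xs (f≤g ∘ there))

  ∑-mono-< : ∀ xs {f g : A → ℕ} → (∀ {x} → x ∈ xs → f x ≤ g x) →
             ∀ {x₀} → x₀ ∈ xs → f x₀ < g x₀ → ∑ xs f < ∑ xs g
  ∑-mono-< (x ∷ xs) f≤g (here refl) fx<gx = +-mono-<-≤ fx<gx (∑-mono-≤ xs (f≤g ∘ there))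
  ∑-mono-< (x ∷ xs) f≤g (there x₀∈xs) fx₀<gx₀ =
    +-mono-≤-< (f≤g (here refl)) (∑-mono-< xs (f≤g ∘ there) x₀∈xs fx₀<gx₀)

  ∑-zero : ∀ xs → ∑ xs (λ (_ : A) → 0) ≡ 0
  ∑-zero []       = refl
  ∑-zero (_ ∷ xs) = ∑-zero xs

  ∑-pos : ∀ xs {f : A → ℕ} {x₀} → x₀ ∈ xs → 0 < f x₀ → 0 < ∑ xs f
  ∑-pos xs {f} x₀∈xs 0<fx₀ = subst (_< ∑ xs f) (∑-zero xs) (∑-mono-< xs (λ _ → z≤n) x₀∈xs 0<fx₀)

  ∑-distrib-+ : ∀ xs (f g : A → ℕ) → ∑ xs (λ x → f x + g x) ≡ ∑ xs f + ∑ xs g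
  ∑-distrib-+ []       f g = refl
  ∑-distrib-+ (x ∷ xs) f g = trans (cong (f x + g x +_) (∑-distrib-+ xs f g))
                                   (interchange +-commutativeSemigroup (f x) (g x) (∑ xs f) (∑ xs g))

  ∑-≤-* : ∀ xs {f : A → ℕ} {b} → (∀ {x} → x ∈ xs → f x ≤ b) → ∑ xs f ≤ length xs * b
  ∑-≤-* []       _    = z≤n
  ∑-≤-* (x ∷ xs) f≤b = +-mono-≤ (f≤b (here refl)) (∑-≤-* xs (f≤b ∘ there))

  ∑-𝟙 : ∀ xs (p : A → Bool) → ∑ xs (𝟙 ∘ p) ≡ length (filterᵇ p xs)
  ∑-𝟙 []       p = refl
  ∑-𝟙 (x ∷ xs) p with p x
  ... | true  = cong suc (∑-𝟙 xs p)
  ... | false = ∑-𝟙 xs p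

  ∑-𝟙-≤1 : ∀ {xs} (p : A → Bool) → Unique xs →
           (∀ {a b} → a ∈ xs → b ∈ xs → p a ≡ true → p b ≡ true → a ≡ b) → ∑ xs (𝟙 ∘ p) ≤ 1
  ∑-𝟙-≤1 {xs} p unique atMostOne = subst (_≤ 1) (sym (∑-𝟙 xs p))
    (Unique∧allEqual⇒length≤1 (filter⁺ (T? ∘ p) unique) λ a∈ b∈ →
      let a∈xs , pa = ∈-filterᵇ⁻ p a∈ ; b∈xs , pb = ∈-filterᵇ⁻ p b∈ in atMostOne a∈xs b∈xs pa pb)

∑-comm : ∀ {A B : Set} (xs : List A) (ys : List B) (f : A → B → ℕ) →
         ∑ xs (λ x → ∑ ys (f x)) ≡ ∑ ys (λ y → ∑ xs (λ x → f x y))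
∑-comm []       ys f = sym (∑-zero ys)
∑-comm (x ∷ xs) ys f = trans (cong (∑ ys (f x) +_) (∑-comm xs ys f))
                             (sym (∑-distrib-+ ys (f x) (λ y → ∑ xs (λ x → f x y))))

_⊆ˢ_ : ∀ {k} → Subset k → Subset k → Set
S ⊆ˢ S′ = ∀ {w} → S w ≡ true → S′ w ≡ true

insert : ∀ {k} → Fin k → Subset k → Subset k
insert b S w = S w ∨ (w == b)

card : ∀ {k} → Subset k → ℕ
card {k} S = ∑ (allFin k) (𝟙 ∘ S)

card≤ : ∀ {k} (S : Subset k) → card S ≤ k
card≤ {k} S = subst (card S ≤_) (trans (*-identityʳ _) (length-tabulate _))
                    (∑-≤-* (allFin k) λ {w} _ → 𝟙≤1 (S w))

full⇒card≥ : ∀ {k} {S : Subset k} → (∀ w → S w ≡ true) → k ≤ card S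
full⇒card≥ {k} {S} isFull = begin
  k                                     ≡⟨ length-tabulate _ ⟨
  length (allFin k)                     ≡⟨ cong length (filter-all (T? ∘ full) (All.universal _ (allFin k))) ⟨
  length (filterᵇ full (allFin k))      ≡⟨ ∑-𝟙 (allFin k) full ⟨
  card {k} full                         ≤⟨ ∑-mono-≤ (allFin k) (λ {w} _ → ≤-reflexive (cong 𝟙 (sym (isFull w)))) ⟩
  card S                                ∎
  where open ≤-Reasoning

card-singleton : ∀ {k} (b : Fin k) → card (λ w → w == b) ≤ 1
card-singleton {k} b = ∑-𝟙-≤1 (_== b) (allFin⁺ k) λ _ _ a==b c==b → trans (==⇒≡ a==b) (sym (==⇒≡ c==b))

card-insert : ∀ {k} (b : Fin k) (S : Subset k) → card (insert b S) ≤ suc (card S)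
card-insert {k} b S = begin
  card (insert b S)                          ≤⟨ ∑-mono-≤ (allFin k) (λ {w} _ → 𝟙-∨ (S w) (w == b)) ⟩
  ∑ (allFin k) (λ w → 𝟙 (S w) + 𝟙 (w == b))  ≡⟨ ∑-distrib-+ (allFin k) (𝟙 ∘ S) (λ w → 𝟙 (w == b)) ⟩
  card S + card (λ w → w == b)               ≤⟨ +-monoʳ-≤ (card S) (card-singleton b) ⟩
  card S + 1                                 ≡⟨ +-comm (card S) 1 ⟩
  suc (card S)                               ∎
  where open ≤-Reasoning

card-mono-< : ∀ {k} {S S′ : Subset k} → S ⊆ˢ S′ → ∀ w → S w ≡ false → S′ w ≡ true → card S < card S′
card-mono-< {k} {S} {S′} S⊆S′ w Sw S′w = ∑-mono-< (allFin k) (λ _ → 𝟙-mono S⊆S′) (∈-allFin w)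
  (subst₂ (λ a b → 𝟙 a < 𝟙 b) (sym Sw) (sym S′w) ≤-refl)

module Iteration {k : ℕ} (f : Subset k → Subset k) (inflationary : ∀ S → S ⊆ˢ f S)
                 (congruent : ∀ {S S′} → (∀ w → S w ≡ S′ w) → ∀ w → f S w ≡ f S′ w) where

  Stable : Subset k → Set
  Stable S = ∀ w → f S w ≡ S w

  iter-inflationary : ∀ m S → S ⊆ˢ iter m f S
  iter-inflationary zero    S Sw = Sw
  iter-inflationary (suc m) S Sw = inflationary _ (iter-inflationary m S Sw)

  stable-after : ∀ S j d → Stable (iter j f S) → Stable (iter (d + j) f S)
  stable-after S j zero    stable = stable
  stable-after S j (suc d) stable = congruent (stable-after S j d stable)

  unstable⇒card-grows : ∀ {S} → ¬ Stable S → card S < card (f S)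
  unstable⇒card-grows {S} unstable
    with w , fSw≢Sw ← ¬∀⟶∃¬ k _ (λ w → f S w ≟ᵇ S w) unstable
    with S w in Sw
  ... | true  = ⊥-elim (fSw≢Sw (inflationary S Sw))
  ... | false = card-mono-< (inflationary S) w Sw (¬-not fSw≢Sw)

  stable-or-card≥ : ∀ S m → (∃ λ j → j < m × Stable (iter j f S)) ⊎ m ≤ card (iter m f S)
  stable-or-card≥ S zero = inj₂ z≤n
  stable-or-card≥ S (suc m) with stable-or-card≥ S m
  ... | inj₁ (j , j<m , stable) = inj₁ (j , m<n⇒m<1+n j<m , stable)
  ... | inj₂ m≤card with all? (λ w → f (iter m f S) w ≟ᵇ iter m f S w)
  ...   | yes stable  = inj₁ (m , n<1+n m , stable)
  ...   | no unstable = inj₂ (<-≤-trans (s≤s m≤card) (unstable⇒card-grows unstable))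

  -- Every unstable step adds an element, so one of the iterates 0, …, k is stable.
  iter-stable : ∀ S → Stable (iter k f S)
  iter-stable S with stable-or-card≥ S (suc k)
  ... | inj₂ k<card = ⊥-elim (<⇒≱ k<card (card≤ _))
  ... | inj₁ (j , j<1+k , stable) =
    subst (λ m → Stable (iter m f S)) (m∸n+n≡m (≤-pred j<1+k)) (stable-after S j (k ∸ j) stable)

-- Walks avoiding a vertex

walk-++ : ∀ {k} {a : Fin k → Fin k → Bool} {x y z} → Walk a x y → Walk a y z → Walk a x z
walk-++ here       q = q
walk-++ (step e p) q = step e (walk-++ p q)

module AvoidingWalks (T : LTree) where

  data Avoiding (v : Fin (size T)) : Fin (size T) → Fin (size T) → Set where
    stop : ∀ {x} → x ≢ v → Avoiding v x x
    go   : ∀ {x y z} → x ≢ v → adj T x y ≡ true → Avoiding v y z → Avoiding v x z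

  source≢ : ∀ {v x z} → Avoiding v x z → x ≢ v
  source≢ (stop x≢v)   = x≢v
  source≢ (go x≢v _ _) = x≢v

  snoc : ∀ {v x y z} → Avoiding v x y → adj T y z ≡ true → z ≢ v → Avoiding v x z
  snoc (stop x≢v)   e z≢v = go x≢v e (stop z≢v)
  snoc (go x≢v e p) f z≢v = go x≢v e (snoc p f z≢v)

  reverse : ∀ {v x z} → Avoiding v x z → Avoiding v z x
  reverse (stop x≢v)   = stop x≢v
  reverse (go x≢v e p) = snoc (reverse p) (trans (adj-sym T _ _) e) x≢v

  _++ᵃ_ : ∀ {v x y z} → Avoiding v x y → Avoiding v y z → Avoiding v x z
  stop _     ++ᵃ q = q
  go x≢v e p ++ᵃ q = go x≢v e (p ++ᵃ q)

  lastExit : ∀ {v x z} → z ≢ v → Walk (adj T) x z → Avoiding v x z ⊎ ∃ λ u → adj T v u ≡ true × Avoiding v u z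
  lastExit z≢v here = inj₁ (stop z≢v)
  lastExit {v} {x} z≢v (step {j = y} e w) with lastExit z≢v w
  ... | inj₂ exit = inj₂ exit
  ... | inj₁ p with x ≟ᶠ v
  ...   | yes refl = inj₂ (y , e , p)
  ...   | no x≢v   = inj₁ (go x≢v e p)

  reachStep-congruent : ∀ v {S S′} → (∀ w → S w ≡ S′ w) → ∀ w → reachStep T v S w ≡ reachStep T v S′ w
  reachStep-congruent v S≗S′ w = cong₂ _∨_ (S≗S′ w)
    (cong (λ b → not (w == v) ∧ or b) (map-cong (λ x → cong (_∧ adj T x w) (S≗S′ x)) (allFin (size T))))

  reachStep-inflationary : ∀ v S → S ⊆ˢ reachStep T v S
  reachStep-inflationary v S {w} Sw = cong (_∨ (not (w == v) ∧ any (λ x → S x ∧ adj T x w) (allFin (size T)))) Sw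

  open module Reach (v : Fin (size T)) =
    Iteration (reachStep T v) (reachStep-inflationary v) (reachStep-congruent v)
    using (iter-inflationary; iter-stable)

  reachable⇒Avoiding : ∀ {v u} → u ≢ v → ∀ m {w} → iter m (reachStep T v) (_== u) w ≡ true → Avoiding v u w
  reachable⇒Avoiding {v} {u} u≢v zero w==u = subst (Avoiding v u) (sym (==⇒≡ w==u)) (stop u≢v)
  reachable⇒Avoiding {v} {u} u≢v (suc m) {w} reached with ∨-true⁻ reached
  ... | inj₁ earlier = reachable⇒Avoiding u≢v m earlier
  ... | inj₂ new
    with w≠v , viaEdge ← ∧-true⁻ new
    with x , _ , reached-x-w ← any-true⁻ (λ z → iter m (reachStep T v) (_== u) z ∧ adj T z w) {allFin (size T)} viaEdge
    with reached-x , x-w ← ∧-true⁻ reached-x-w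
    = snoc (reachable⇒Avoiding u≢v m reached-x) x-w (not-==⇒≢ w≠v)

  compAvoid-closed : ∀ {v u x w} → compAvoid T v u x ≡ true → adj T x w ≡ true → w ≢ v → compAvoid T v u w ≡ true
  compAvoid-closed {v} {u} {x} {w} reached-x x-w w≢v = begin
    R w                                ≡⟨ iter-stable v (_== u) w ⟨
    R w ∨ (not (w == v) ∧ someEdge)    ≡⟨ cong (λ b → R w ∨ (not b ∧ someEdge)) (≢⇒==-false w≢v) ⟩
    R w ∨ someEdge                     ≡⟨ cong (R w ∨_) (any-true⁺ (λ z → R z ∧ adj T z w) (∈-allFin x) x-edge) ⟩
    R w ∨ true                         ≡⟨ ∨-zeroʳ (R w) ⟩
    true                               ∎
    where
    open ≡-Reasoning
    R = compAvoid T v u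
    someEdge = any (λ z → R z ∧ adj T z w) (allFin (size T))
    x-edge : R x ∧ adj T x w ≡ true
    x-edge = cong₂ _∧_ reached-x x-w

  Avoiding⇒compAvoid : ∀ {v u x} → Avoiding v u x → compAvoid T v u x ≡ true
  Avoiding⇒compAvoid {v} {u} p = extend p (iter-inflationary v (size T) (_== u) (==-refl u))
    where
    extend : ∀ {a x} → Avoiding v a x → compAvoid T v u a ≡ true → compAvoid T v u x ≡ true
    extend (stop _)   reached-a = reached-a
    extend (go _ e p) reached-a = extend p (compAvoid-closed reached-a e (source≢ p))

  compAvoid⇒Avoiding : ∀ {v u x} → u ≢ v → compAvoid T v u x ≡ true → Avoiding v u x
  compAvoid⇒Avoiding u≢v = reachable⇒Avoiding u≢v (size T)

Symmetric : ∀ {k} → (Fin k → Fin k → Bool) → Set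
Symmetric a = ∀ i j → a i j ≡ a j i

_⊆ᵃ_ : ∀ {k} → (Fin k → Fin k → Bool) → (Fin k → Fin k → Bool) → Set
a ⊆ᵃ a′ = ∀ {i j} → a i j ≡ true → a′ i j ≡ true

-- edgesIn a S unfolds to ∑ i ∑ j edgeTerm a S i j: each edge is counted from its smaller endpoint.
edgeTerm : ∀ {k} → (Fin k → Fin k → Bool) → Subset k → Fin k → Fin k → ℕ
edgeTerm a S i j = 𝟙 ((toℕ i <ᵇ toℕ j) ∧ S i ∧ S j ∧ a i j)

edgeCounted⁻ : ∀ {k} {a : Fin k → Fin k → Bool} {S : Subset k} {i j} →
               (toℕ i <ᵇ toℕ j) ∧ S i ∧ S j ∧ a i j ≡ true → S i ≡ true × S j ≡ true × a i j ≡ true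
edgeCounted⁻ {i = i} {j} p with _ , q ← ∧-true⁻ {toℕ i <ᵇ toℕ j} p with Si , r ← ∧-true⁻ q = Si , ∧-true⁻ r

module _ {k} {a a′ : Fin k → Fin k → Bool} {S S′ : Subset k} (a⊆a′ : a ⊆ᵃ a′) (S⊆S′ : S ⊆ˢ S′) where

  edgeTerm-mono : ∀ i j → edgeTerm a S i j ≤ edgeTerm a′ S′ i j
  edgeTerm-mono i j = 𝟙-mono (∧-mono {toℕ i <ᵇ toℕ j} id (∧-mono (S⊆S′ {i}) (∧-mono (S⊆S′ {j}) (a⊆a′ {i} {j}))))

  edgesIn-mono : edgesIn a S ≤ edgesIn a′ S′
  edgesIn-mono = ∑-mono-≤ (allFin k) λ {i} _ → ∑-mono-≤ (allFin k) λ {j} _ → edgeTerm-mono i j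

  private
    strictAt : ∀ i j → edgeTerm a S i j ≡ 0 → edgeTerm a′ S′ i j ≡ 1 → edgesIn a S < edgesIn a′ S′
    strictAt i j old new = ∑-mono-< (allFin k) (λ {i} _ → ∑-mono-≤ (allFin k) λ {j} _ → edgeTerm-mono i j) (∈-allFin i)
      (∑-mono-< (allFin k) (λ {j} _ → edgeTerm-mono i j) (∈-allFin j) (subst₂ _<_ (sym old) (sym new) ≤-refl))

    <ᵇ-true : ∀ {i j : Fin k} → toℕ i < toℕ j → (toℕ i <ᵇ toℕ j) ≡ true
    <ᵇ-true i<j = Equivalence.to T-≡ (<⇒<ᵇ i<j)

  edgesIn-mono-< : Symmetric a → Symmetric a′ → ∀ {c b} → c ≢ b → S′ c ≡ true → S′ b ≡ true → a′ c b ≡ true →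
                   S c ∧ S b ∧ a c b ≡ false → edgesIn a S < edgesIn a′ S′
  edgesIn-mono-< a-sym a′-sym {c} {b} c≢b S′c S′b a′cb uncounted with <-cmp (toℕ c) (toℕ b)
  ... | tri≈ _ c≡b _ = ⊥-elim (c≢b (toℕ-injective c≡b))
  ... | tri< c<b _ _ = strictAt c b old new
    where
    old : edgeTerm a S c b ≡ 0
    old rewrite <ᵇ-true c<b | uncounted = refl
    new : edgeTerm a′ S′ c b ≡ 1
    new rewrite <ᵇ-true c<b | S′c | S′b | a′cb = refl
  ... | tri> _ _ b<c = strictAt b c old new
    where
    old : edgeTerm a S b c ≡ 0
    old rewrite <ᵇ-true b<c | sym (a-sym c b) | ∧-swap (S b) (S c) (a c b) | uncounted = refl
    new : edgeTerm a′ S′ b c ≡ 1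
    new rewrite <ᵇ-true b<c | S′c | S′b | a′-sym b c | a′cb = refl

-- Grow a set S ∋ r along edges leaving it: each step adds one vertex and at least one edge inside S.
module _ {k} (a : Fin k → Fin k → Bool) (a-sym : Symmetric a) (r : Fin k) (reach : ∀ x → Walk a r x) where

  private
    Grown : Subset k → Set
    Grown S = S r ≡ true × card S ≤ suc (edgesIn a S)

    exitEdge : ∀ {S : Subset k} {s x} → S s ≡ true → S x ≡ false → Walk a s x →
               ∃ λ c → ∃ λ b → S c ≡ true × S b ≡ false × a c b ≡ true
    exitEdge Ss Sx here with () ← trans (sym Ss) Sx
    exitEdge {S} Ss Sx (step {j = b} e w) with S b in Sb
    ... | true  = exitEdge Sb Sx w
    ... | false = _ , b , Ss , Sb , e

    grow : ∀ {S : Subset k} {c b} → Grown S → S c ≡ true → S b ≡ false → a c b ≡ true →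
           Grown (insert b S) × card S < card (insert b S)
    grow {S} {c} {b} (Sr , card≤) Sc Sb e = (S⊆S+b Sr , card≤′) , card-mono-< S⊆S+b b Sb S+b-b
      where
      S⊆S+b : S ⊆ˢ insert b S
      S⊆S+b {w} Sw = cong (_∨ (w == b)) Sw
      S+b-b : insert b S b ≡ true
      S+b-b = trans (cong (S b ∨_) (==-refl b)) (∨-zeroʳ (S b))
      uncounted : S c ∧ S b ∧ a c b ≡ false
      uncounted rewrite Sc | Sb = refl
      more-edges : edgesIn a S < edgesIn a (insert b S)
      more-edges = edgesIn-mono-< id S⊆S+b a-sym a-sym (λ { refl → case trans (sym Sc) Sb of λ () })
                                  (S⊆S+b Sc) S+b-b e uncounted
      card≤′ : card (insert b S) ≤ suc (edgesIn a (insert b S))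
      card≤′ = ≤-trans (card-insert b S) (s≤s (≤-trans card≤ more-edges))

    growing : ∀ m → ∃ λ S → Grown S × (m ≤ card S ⊎ (∀ w → S w ≡ true))
    growing zero = (_== r) , (==-refl r , ≤-trans (card-singleton r) (s≤s z≤n)) , inj₁ z≤n
    growing (suc m) with growing m
    ... | S , grown , inj₂ isFull = S , grown , inj₂ isFull
    ... | S , grown , inj₁ m≤card with all? (λ w → S w ≟ᵇ true)
    ...   | yes isFull = S , grown , inj₂ isFull
    ...   | no ¬full
      with x , Sx≢true ← ¬∀⟶∃¬ k _ (λ w → S w ≟ᵇ true) ¬full
      with c , b , Sc , Sb , e ← exitEdge (proj₁ grown) (¬-not Sx≢true) (reach x)
      with grown′ , larger ← grow grown Sc Sb e
      = insert b S , grown′ , inj₁ (≤-<-trans m≤card larger)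

  connected⇒size≤1+edges : k ≤ suc (edgesIn a full)
  connected⇒size≤1+edges with growing (suc k)
  ... | S , _ , inj₁ k<card = ⊥-elim (<⇒≱ k<card (card≤ S))
  ... | S , (_ , card≤) , inj₂ isFull =
    ≤-trans (full⇒card≥ isFull) (≤-trans card≤ (s≤s (edgesIn-mono {a = a} {S = S} id (λ _ → refl))))

module _ {k} {I : Set} (a : Fin k → Fin k → Bool) {us : List I} (D : I → Subset k) (unique : Unique us)
         (edgeDisjoint : ∀ {i j u u′} → a i j ≡ true → u ∈ us → u′ ∈ us →
                         D u i ≡ true → D u j ≡ true → D u′ i ≡ true → D u′ j ≡ true → u ≡ u′) where

  private
    pairBound : ∀ i j → ∑ us (λ u → edgeTerm a (D u) i j) ≤ edgeTerm a full i j
    pairBound i j with (toℕ i <ᵇ toℕ j) ∧ a i j in isEdge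
    ... | false = ≤-trans (∑-mono-≤ us λ {u} _ → subst (edgeTerm a (D u) i j ≤_) (cong 𝟙 isEdge)
                                                       (edgeTerm-mono {a = a} {S = D u} id (λ _ → refl) i j))
                          (≤-trans (≤-reflexive (∑-zero us)) z≤n)
    ... | true  = ∑-𝟙-≤1 (λ u → (toℕ i <ᵇ toℕ j) ∧ D u i ∧ D u j ∧ a i j) unique atMostOne
      where
      atMostOne : ∀ {u u′} → u ∈ us → u′ ∈ us → (toℕ i <ᵇ toℕ j) ∧ D u i ∧ D u j ∧ a i j ≡ true →
                  (toℕ i <ᵇ toℕ j) ∧ D u′ i ∧ D u′ j ∧ a i j ≡ true → u ≡ u′
      atMostOne {u} {u′} u∈ u′∈ p p′
        with Dui , Duj , e ← edgeCounted⁻ {a = a} {D u} {i} {j} p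
           | D′i , D′j , _ ← edgeCounted⁻ {a = a} {D u′} {i} {j} p′ =
        edgeDisjoint e u∈ u′∈ Dui Duj D′i D′j

  ∑-edgesIn≤ : ∑ us (λ u → edgesIn a (D u)) ≤ edgesIn a full
  ∑-edgesIn≤ = begin
    ∑ us (λ u → ∑ (allFin k) λ i → ∑ (allFin k) λ j → edgeTerm a (D u) i j)
      ≡⟨ ∑-comm us (allFin k) _ ⟩
    ∑ (allFin k) (λ i → ∑ us λ u → ∑ (allFin k) λ j → edgeTerm a (D u) i j)
      ≡⟨ cong sum (map-cong (λ i → ∑-comm us (allFin k) (λ u j → edgeTerm a (D u) i j)) (allFin k)) ⟩
    ∑ (allFin k) (λ i → ∑ (allFin k) λ j → ∑ us λ u → edgeTerm a (D u) i j)
      ≤⟨ ∑-mono-≤ (allFin k) (λ {i} _ → ∑-mono-≤ (allFin k) λ {j} _ → pairBound i j) ⟩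
    edgesIn a full ∎
    where open ≤-Reasoning

-- Trees and the subtrees split by a vertex

module Tree (T : LTree) where

  open AvoidingWalks T

  private
    N = size T
    A = adj T

  adjacent⇒≢ : ∀ {i j} → A i j ≡ true → i ≢ j
  adjacent⇒≢ {i} e refl with () ← trans (sym e) (adj-irr T i)

  -- Deleting the edge v u′ keeps T connected (reroute it through u and the cycle), which leaves
  -- N vertices with only N − 2 edges.
  module _ {v u u′ : Fin N} (u≢u′ : u ≢ u′) (vu : A v u ≡ true) (vu′ : A v u′ ≡ true) where

    private
      removed : Fin N → Fin N → Bool
      removed a b = (a == v ∧ b == u′) ∨ (b == v ∧ a == u′)

      A⁻ : Fin N → Fin N → Bool
      A⁻ a b = A a b ∧ not (removed a b)

      A⁻-sym : Symmetric A⁻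
      A⁻-sym a b = cong₂ (λ x y → x ∧ not y) (adj-sym T a b) (∨-comm (a == v ∧ b == u′) (b == v ∧ a == u′))

      kept : ∀ {a b} → a ≢ v → b ≢ v → A a b ≡ true → A⁻ a b ≡ true
      kept a≢v b≢v e rewrite ≢⇒==-false a≢v | ≢⇒==-false b≢v | e = refl

      kept-vu : A⁻ v u ≡ true
      kept-vu rewrite ==-refl v | ≢⇒==-false u≢u′ | ≢⇒==-false (adjacent⇒≢ vu′)
                    | ≢⇒==-false (adjacent⇒≢ vu ∘ sym) | vu = refl

      avoiding⇒Walk⁻ : ∀ {a b} → Avoiding v a b → Walk A⁻ a b
      avoiding⇒Walk⁻ (stop _)       = here
      avoiding⇒Walk⁻ (go a≢v e p) = step (kept a≢v (source≢ p) e) (avoiding⇒Walk⁻ p)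

      ==∧==⇒≡ : ∀ {a b c d : Fin N} → (a == b ∧ c == d) ≡ true → a ≡ b × c ≡ d
      ==∧==⇒≡ p with a==b , c==d ← ∧-true⁻ p = ==⇒≡ a==b , ==⇒≡ c==d

    noCycleThrough : ¬ Avoiding v u u′
    noCycleThrough cycle = fin⇒n≰n∸1 v (begin
      N                         ≤⟨ connected⇒size≤1+edges A⁻ A⁻-sym v (reroute ∘ connected T v) ⟩
      suc (edgesIn A⁻ full)     ≤⟨ edgesIn-mono-< {S = full} (λ p → proj₁ (∧-true⁻ p)) id A⁻-sym (adj-sym T)
                                                  (adjacent⇒≢ vu′) refl refl vu′ removed-vu′ ⟩
      edgesIn A full            ≡⟨ edgeCount T ⟩
      N ∸ 1                     ∎)
      where
      open ≤-Reasoning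
      fin⇒n≰n∸1 : ∀ {n} → Fin n → ¬ (n ≤ n ∸ 1)
      fin⇒n≰n∸1 {suc n} _ = <-irrefl refl

      removed-vu′ : A⁻ v u′ ≡ false
      removed-vu′ rewrite ==-refl v | ==-refl u′ = ∧-zeroʳ (A v u′)

      reroute : ∀ {a b} → Walk A a b → Walk A⁻ a b
      reroute here = here
      reroute {a} (step {j = b} e w) with removed a b in eq
      ... | false = step (cong₂ (λ x y → x ∧ not y) e eq) (reroute w)
      ... | true with ∨-true⁻ eq
      ...   | inj₁ forward with refl , refl ← ==∧==⇒≡ {a} {v} {b} {u′} forward =
        step kept-vu (walk-++ (avoiding⇒Walk⁻ cycle) (reroute w))
      ...   | inj₂ backward with refl , refl ← ==∧==⇒≡ {b} {v} {a} {u′} backward =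
        walk-++ (avoiding⇒Walk⁻ (reverse cycle)) (step (trans (A⁻-sym u v) kept-vu) (reroute w))

  neighbours : Fin N → List (Fin N)
  neighbours v = filterᵇ (A v) (allFin N)

  ∈-neighbours⁻ : ∀ {v u} → u ∈ neighbours v → A v u ≡ true
  ∈-neighbours⁻ {v} u∈ = proj₂ (∈-filterᵇ⁻ (A v) {allFin N} u∈)

  length-neighbours : ∀ v → length (neighbours v) ≡ deg T v
  length-neighbours v = sym (∑-𝟙 (allFin N) (A v))

  module _ {v u : Fin N} (vu : A v u ≡ true) where

    split-root : split T v u v ≡ true
    split-root = cong (_∨ compAvoid T v u v) (==-refl v)

    split⇒Avoiding : ∀ {x} → x ≢ v → split T v u x ≡ true → Avoiding v u x
    split⇒Avoiding {x} x≢v x∈D =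
      compAvoid⇒Avoiding (adjacent⇒≢ vu ∘ sym) (subst (λ b → b ∨ compAvoid T v u x ≡ true) (≢⇒==-false x≢v) x∈D)

    Avoiding⇒split : ∀ {x} → Avoiding v u x → split T v u x ≡ true
    Avoiding⇒split {x} p = trans (cong ((x == v) ∨_) (Avoiding⇒compAvoid p)) (∨-zeroʳ (x == v))

    split-closed : ∀ {x w} → x ≢ v → split T v u x ≡ true → A x w ≡ true → split T v u w ≡ true
    split-closed {x} {w} x≢v x∈D e with w ≟ᶠ v
    ... | yes refl = split-root
    ... | no w≢v   = Avoiding⇒split (snoc (split⇒Avoiding x≢v x∈D) e w≢v)

    split-deg : ∀ {x} → x ≢ v → split T v u x ≡ true → degIn A (split T v u) x ≡ deg T x
    split-deg {x} x≢v x∈D = cong sum (map-cong (λ w → cong 𝟙 (inside w)) (allFin N))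
      where
      inside : ∀ w → split T v u w ∧ A x w ≡ A x w
      inside w with A x w in e
      ... | true  = trans (cong (_∧ true) (split-closed x≢v x∈D e)) refl
      ... | false = ∧-zeroʳ _

    split-leaf : ∀ {x} → x ≢ v → x ∈ leavesIn A (split T v u) → x ∈ leafVec T
    split-leaf {x} x≢v x∈leaves
      with x∈D , isLeaf ← ∧-true⁻ (proj₂ (∈-filterᵇ⁻ (λ w → split T v u w ∧ (degIn A (split T v u) w ≡ᵇ 1))
                                                      {allFin N} x∈leaves)) =
      ∈-filterᵇ⁺ (λ w → deg T w ≡ᵇ 1) (∈-allFin x) (subst (λ d → (d ≡ᵇ 1) ≡ true) (split-deg x≢v x∈D) isLeaf)

    split-edges-pos : 0 < edgesIn A (split T v u)
    split-edges-pos = ≤-trans (s≤s z≤n)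
      (edgesIn-mono-< {S = λ _ → false} {S′ = split T v u} id (λ ()) (adj-sym T) (adj-sym T) (adjacent⇒≢ vu)
                      split-root (Avoiding⇒split (stop (adjacent⇒≢ vu ∘ sym))) vu refl)

  split-cover : ∀ {v x} → x ≢ v → ∃ λ u → u ∈ neighbours v × split T v u x ≡ true
  split-cover {v} {x} x≢v with lastExit x≢v (connected T v x)
  ... | inj₁ p = ⊥-elim (source≢ p refl)
  ... | inj₂ (u , vu , p) = u , ∈-filterᵇ⁺ (A v) (∈-allFin u) vu , Avoiding⇒split vu p

  split-disjoint : ∀ {v u u′ x} → A v u ≡ true → A v u′ ≡ true → x ≢ v →
                   split T v u x ≡ true → split T v u′ x ≡ true → u ≡ u′
  split-disjoint {v} {u} {u′} vu vu′ x≢v x∈D x∈D′ with u ≟ᶠ u′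
  ... | yes u≡u′ = u≡u′
  ... | no u≢u′ =
    ⊥-elim (noCycleThrough u≢u′ vu vu′ (split⇒Avoiding vu x≢v x∈D ++ᵃ reverse (split⇒Avoiding vu′ x≢v x∈D′)))

  ∑-split-edges≤ : ∀ v → ∑ (neighbours v) (λ u → edgesIn A (split T v u)) ≤ e T
  ∑-split-edges≤ v = ∑-edgesIn≤ A (split T v) (filter⁺ (T? ∘ A v) (allFin⁺ N)) edgeDisjoint
    where
    edgeDisjoint : ∀ {i j u u′} → A i j ≡ true → u ∈ neighbours v → u′ ∈ neighbours v →
                   split T v u i ≡ true → split T v u j ≡ true → split T v u′ i ≡ true → split T v u′ j ≡ true → u ≡ u′
    edgeDisjoint {i} {j} ij u∈ u′∈ Dui Duj D′i D′j with i ≟ᶠ v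
    ... | no i≢v   = split-disjoint (∈-neighbours⁻ u∈) (∈-neighbours⁻ u′∈) i≢v Dui D′i
    ... | yes refl = split-disjoint (∈-neighbours⁻ u∈) (∈-neighbours⁻ u′∈) (adjacent⇒≢ ij ∘ sym) Duj D′j

  nonLeaf⇒2≤deg : ∀ {v x} → x ≢ v → deg T v ≢ 1 → 2 ≤ length (neighbours v)
  nonLeaf⇒2≤deg {v} {x} x≢v deg≢1 with split-cover x≢v
  ... | u , u∈ , _ = subst (2 ≤_) (sym (length-neighbours v))
                           (≤∧≢⇒< (subst (1 ≤_) (length-neighbours v) (∈-length u∈)) (deg≢1 ∘ sym))

record Maximal {A : Set} (R : A → A → Set) (xs : List A) : Set where
  field
    members  : List A
    members⊆ : members ⊆ xs
    pairwise : AllPairs R members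
    maximal  : ∀ {x} → x ∈ xs → x ∈ members ⊎ ∃ λ m → m ∈ members × ¬ R x m

maximal-AllPairs : ∀ {A : Set} {R : A → A → Set} → Decidable R → ∀ xs → Maximal R xs
maximal-AllPairs R? [] = record { members = [] ; members⊆ = λ () ; pairwise = [] ; maximal = λ () }
maximal-AllPairs R? (x ∷ xs) with maximal-AllPairs R? xs
... | record { members = M ; members⊆ = M⊆xs ; pairwise = pairwise ; maximal = maximal } with All.all? (R? x) M
...   | yes x~M = record
  { members  = x ∷ M
  ; members⊆ = λ { (here refl) → here refl ; (there m∈) → there (M⊆xs m∈) }
  ; pairwise = x~M ∷ pairwise
  ; maximal  = λ { (here refl) → inj₁ (here refl) ; (there z∈) → Sum.map there (map₂ (map₁ there)) (maximal z∈) }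
  }
...   | no ¬x~M = record
  { members  = M
  ; members⊆ = there ∘ M⊆xs
  ; pairwise = pairwise
  ; maximal  = λ { (here refl) → inj₂ (find (¬All⇒Any¬ (R? x) M ¬x~M)) ; (there z∈) → maximal z∈ }
  }

cover⇒length≤∑ : ∀ {A I : Set} (Q : I → A → Bool) (rs : List I) (xs : List A) →
                 (∀ {x} → x ∈ xs → ∃ λ r → r ∈ rs × Q r x ≡ true) →
                 length xs ≤ ∑ rs (λ r → length (filterᵇ (Q r) xs))
cover⇒length≤∑ Q rs []       _       = z≤n
cover⇒length≤∑ Q rs (x ∷ xs) covered with r , r∈ , Qrx ← covered (here refl) = begin
  1 + length xs
    ≤⟨ +-mono-≤ (∑-pos rs r∈ (subst (λ b → 0 < 𝟙 b) (sym Qrx) (s≤s z≤n))) (cover⇒length≤∑ Q rs xs (covered ∘ there)) ⟩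
  ∑ rs (λ r → 𝟙 (Q r x)) + ∑ rs (λ r → length (filterᵇ (Q r) xs))
    ≡⟨ ∑-distrib-+ rs (λ r → 𝟙 (Q r x)) (λ r → length (filterᵇ (Q r) xs)) ⟨
  ∑ rs (λ r → 𝟙 (Q r x) + length (filterᵇ (Q r) xs))
    ≡⟨ cong sum (map-cong (λ r → length-filterᵇ-∷ (Q r) x xs) rs) ⟨
  ∑ rs (λ r → length (filterᵇ (Q r) (x ∷ xs)))
    ∎
  where open ≤-Reasoning

module _ {A I : Set} (R : I → A → A → Set) (R-isDecEquivalence : ∀ u → IsDecEquivalence (R u)) where

  -- A maximal R u-inequivalent sublist has at most c u elements, and its R u-classes cover L.
  length≤product : ∀ (us : List I) (c : I → ℕ) {ambient : List A} →
    (∀ {u} → u ∈ us → ∀ {K} → K ⊆ ambient → AllPairs (λ a b → ¬ R u a b) K → length K ≤ c u) →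
    ∀ {L} → Unique L → L ⊆ ambient → (∀ {a b} → a ∈ L → b ∈ L → (∀ {u} → u ∈ us → R u a b) → a ≡ b) →
    length L ≤ product (map c us)
  length≤product [] c _ unique _ determined = Unique∧allEqual⇒length≤1 unique λ a∈ b∈ → determined a∈ b∈ λ ()
  length≤product (u ∷ us) c bounded {L} unique L⊆ambient determined = begin
    length L                                  ≤⟨ cover⇒length≤∑ class members L covered ⟩
    ∑ members (λ r → length (filterᵇ (class r) L)) ≤⟨ ∑-≤-* members (λ {r} _ → classBound r) ⟩
    length members * product (map c us)       ≤⟨ *-monoˡ-≤ _ (bounded (here refl) (L⊆ambient ∘ members⊆) pairwise) ⟩
    c u * product (map c us)                  ∎
    where
    open ≤-Reasoning
    open IsDecEquivalence (R-isDecEquivalence u) using (_≟_) renaming (refl to R-refl; sym to R-sym; trans to R-trans)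
    open Maximal (maximal-AllPairs (λ a b → ¬? (a ≟ b)) L)

    class : A → A → Bool
    class r x = does (x ≟ r)

    class⇒R : ∀ {r x} → class r x ≡ true → R u x r
    class⇒R {r} {x} p with x ≟ r
    ... | yes xRr = xRr
    ... | no _ with () ← p

    covered : ∀ {x} → x ∈ L → ∃ λ r → r ∈ members × class r x ≡ true
    covered {x} x∈ with maximal x∈
    ... | inj₁ x∈M = x , x∈M , dec-true (x ≟ x) R-refl
    ... | inj₂ (r , r∈M , ¬¬xRr) = r , r∈M , dec-true (x ≟ r) (decidable-stable (x ≟ r) ¬¬xRr)

    classBound : ∀ r → length (filterᵇ (class r) L) ≤ product (map c us)
    classBound r = length≤product us c (bounded ∘ there) (filter⁺ (T? ∘ class r) unique) (L⊆ambient ∘ proj₁ ∘ ∈-class⁻)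
      λ a∈ b∈ agree → determined (proj₁ (∈-class⁻ a∈)) (proj₁ (∈-class⁻ b∈)) λ
        { (here refl) → R-trans (class⇒R (proj₂ (∈-class⁻ a∈))) (R-sym (class⇒R (proj₂ (∈-class⁻ b∈))))
        ; (there u∈)  → agree u∈ }
      where
      ∈-class⁻ : ∀ {x} → x ∈ filterᵇ (class r) L → x ∈ L × class r x ≡ true
      ∈-class⁻ = ∈-filterᵇ⁻ (class r) {L}

n∸1<n : ∀ {n} → 0 < n → n ∸ 1 < n
n∸1<n {suc n} _ = ≤-refl

module _ (h : ℕ) .{{_ : NonZero h}} where

  private
    h^-pos : ∀ k → 0 < h ^ k
    h^-pos = m^n>0 h

  ∏pow∸1≤pow-sum² : ∀ es → product (map (λ e → h ^ (e * e) ∸ 1) es) ≤ h ^ (sum es * sum es)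
  ∏pow∸1≤pow-sum² []       = ≤-refl
  ∏pow∸1≤pow-sum² (e ∷ es) = begin
    (h ^ (e * e) ∸ 1) * product (map (λ e → h ^ (e * e) ∸ 1) es) ≤⟨ *-mono-≤ (m∸n≤m (h ^ (e * e)) 1) (∏pow∸1≤pow-sum² es) ⟩
    h ^ (e * e) * h ^ (s * s)                                  ≡⟨ ^-distribˡ-+-* h (e * e) (s * s) ⟨
    h ^ (e * e + s * s)                                        ≤⟨ ^-monoʳ-≤ h (squares≤square-sum e s) ⟩
    h ^ ((e + s) * (e + s))                                    ∎
    where
    open ≤-Reasoning
    s = sum es
    squares≤square-sum : ∀ a b → a * a + b * b ≤ (a + b) * (a + b)
    squares≤square-sum a b = subst (a * a + b * b ≤_) (expand a b) (m≤m+n _ _)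
      where
      expand : ∀ a b → a * a + b * b + 2 * (a * b) ≡ (a + b) * (a + b)
      expand = solve-∀

  ∏pow∸1<pow : ∀ es t → 2 ≤ length es → All (0 <_) es → sum es ≤ t →
               product (map (λ e → h ^ (e * e) ∸ 1) es) < h ^ ((t ∸ 1) * (t ∸ 1) + 1)
  ∏pow∸1<pow (a ∷ es@(b₀ ∷ _)) t _ (0<a ∷ 0<b₀ ∷ _) sum≤t = begin-strict
    (h ^ (a * a) ∸ 1) * product (map (λ e → h ^ (e * e) ∸ 1) es) ≤⟨ *-monoʳ-≤ (h ^ (a * a) ∸ 1) (∏pow∸1≤pow-sum² es) ⟩
    (h ^ (a * a) ∸ 1) * h ^ (b * b)
      <⟨ *-monoˡ-< (h ^ (b * b)) {{>-nonZero (h^-pos (b * b))}} (n∸1<n (h^-pos (a * a))) ⟩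
    h ^ (a * a) * h ^ (b * b)                        ≡⟨ ^-distribˡ-+-* h (a * a) (b * b) ⟨
    h ^ (a * a + b * b)
      ≤⟨ ^-monoʳ-≤ h (two-squares a b t 0<a (≤-trans 0<b₀ (m≤m+n b₀ _)) sum≤t) ⟩
    h ^ ((t ∸ 1) * (t ∸ 1) + 1)                      ∎
    where
    open ≤-Reasoning
    b = sum es
    two-squares : ∀ a b t → 0 < a → 0 < b → a + b ≤ t → a * a + b * b ≤ (t ∸ 1) * (t ∸ 1) + 1
    two-squares (suc a) (suc b) t _ _ a+b≤t = begin
      suc a * suc a + suc b * suc b                  ≤⟨ m≤m+n _ (2 * (a * b)) ⟩
      suc a * suc a + suc b * suc b + 2 * (a * b)    ≡⟨ expand a b ⟩
      suc (a + b) * suc (a + b) + 1                  ≤⟨ +-monoˡ-≤ 1 (*-mono-≤ 1+a+b≤t∸1 1+a+b≤t∸1) ⟩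
      (t ∸ 1) * (t ∸ 1) + 1                          ∎
      where
      expand : ∀ a b → suc a * suc a + suc b * suc b + 2 * (a * b) ≡ suc (a + b) * suc (a + b) + 1
      expand = solve-∀
      1+a+b≤t∸1 : suc (a + b) ≤ t ∸ 1
      1+a+b≤t∸1 = ∸-monoˡ-≤ 1 (subst (_≤ t) (cong suc (+-suc a b)) a+b≤t)
  ∏pow∸1<pow (_ ∷ []) _ (s≤s ()) _ _

  private
    square≤2^ : ∀ m → suc m * suc m ≤ 2 ^ (m + m)
    square≤2^ zero    = ≤-refl
    square≤2^ (suc m) = begin
      suc (suc m) * suc (suc m)     ≤⟨ *-mono-≤ (m≤n+m _ m) (m≤n+m _ m) ⟩
      (m + suc (suc m)) * (m + suc (suc m)) ≡⟨ quadruple m ⟩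
      4 * (suc m * suc m)          ≤⟨ *-monoʳ-≤ 4 (square≤2^ m) ⟩
      4 * 2 ^ (m + m)              ≡⟨ quadruple′ (2 ^ (m + m)) ⟩
      2 * (2 * 2 ^ (m + m))        ≡⟨ cong (λ k → 2 * 2 ^ k) (+-suc m m) ⟨
      2 ^ (suc m + suc m)          ∎
      where
      open ≤-Reasoning
      quadruple : ∀ m → (m + suc (suc m)) * (m + suc (suc m)) ≡ 4 * (suc m * suc m)
      quadruple = solve-∀
      quadruple′ : ∀ x → 4 * x ≡ 2 * (2 * x)
      quadruple′ = solve-∀

    pred-product< : ∀ a b c → 0 < a → 0 < b → 0 < c → (a ∸ 1) * b * (c ∸ 1) < a * b * c
    pred-product< a b c 0<a 0<b 0<c = begin-strict
      (a ∸ 1) * b * (c ∸ 1)   ≤⟨ *-monoʳ-≤ ((a ∸ 1) * b) (m∸n≤m c 1) ⟩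
      (a ∸ 1) * b * c         <⟨ *-monoˡ-< c {{>-nonZero 0<c}} (*-monoˡ-< b {{>-nonZero 0<b}} (n∸1<n 0<a)) ⟩
      a * b * c               ∎
      where open ≤-Reasoning

  -- t² = ((t − 1)² + 1) + 2(t − 1), and 2(t − 1)² ≤ 2^(2t − 3) ≤ h^(2t − 3).
  doubled-count<h^t² : ∀ t → 2 ≤ h → 2 ≤ t →
                       2 * ((h ∸ 1) * ((t ∸ 1) * (t ∸ 1)) * (h ^ ((t ∸ 1) * (t ∸ 1) + 1) ∸ 1)) < h ^ (t * t)
  doubled-count<h^t² (suc (suc m)) 2≤h _ = begin-strict
    2 * ((h ∸ 1) * (s * s) * (X ∸ 1))     ≡⟨ shuffle (h ∸ 1) (s * s) (X ∸ 1) ⟩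
    (h ∸ 1) * (2 * (s * s)) * (X ∸ 1)     ≤⟨ *-monoˡ-≤ (X ∸ 1) (*-monoʳ-≤ (h ∸ 1) 2s²≤h^k) ⟩
    (h ∸ 1) * h ^ k * (X ∸ 1)
      <⟨ pred-product< h (h ^ k) X (≤-trans (s≤s z≤n) 2≤h) (h^-pos k) (h^-pos (s * s + 1)) ⟩
    h ^ suc k * X                         ≡⟨ ^-distribˡ-+-* h (suc k) (s * s + 1) ⟨
    h ^ (suc k + (s * s + 1))             ≡⟨ cong (h ^_) (exponents m) ⟩
    h ^ (suc (suc m) * suc (suc m))       ∎
    where
    open ≤-Reasoning
    s = suc m
    k = suc (m + m)
    X = h ^ (s * s + 1)
    shuffle : ∀ a b c → 2 * (a * b * c) ≡ a * (2 * b) * c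
    shuffle = solve-∀
    exponents : ∀ m → suc (suc (m + m)) + (suc m * suc m + 1) ≡ suc (suc m) * suc (suc m)
    exponents = solve-∀
    2s²≤h^k : 2 * (s * s) ≤ h ^ k
    2s²≤h^k = ≤-trans (*-monoʳ-≤ 2 (square≤2^ m)) (^-monoˡ-≤ k 2≤h)
  doubled-count<h^t² (suc zero) _ (s≤s ())

-- Linked families

module Linking {n : ℕ} (T : LTree) (h : ℕ) .{{_ : NonZero h}} (𝓕 : List (Map T n)) (unique : Unique 𝓕)
               (admissible : All (Admissible T h 𝓕) 𝓕) (y : List (Fin n))
               (sameLeaves : All (λ φ → leafVecOf T φ ≡ y) 𝓕) (2≤t : 2 ≤ e T) where

  open Tree T
  open import Data.List.Membership.DecPropositional (_≟ᶠ_ {n}) using (_∈?_)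

  private
    N = size T
    t = e T

  X : ℕ
  X = h ^ ((t ∸ 1) * (t ∸ 1) + 1)

  size≡1+t : N ≡ suc t
  size≡1+t = 1+pred (size T) (edgeCount T)
    where
    1+pred : ∀ s → t ≡ s ∸ 1 → s ≡ suc t
    1+pred (suc s) t≡s = cong suc (sym t≡s)
    1+pred zero    t≡0 with () ← ≤-trans 2≤t (≤-reflexive t≡0)

  leaf-image∈y : ∀ {φ x} → φ ∈ 𝓕 → x ∈ leafVec T → V.lookup φ x ∈ y
  leaf-image∈y {φ} φ∈ x∈ = subst (V.lookup φ _ ∈_) (All.lookup sameLeaves φ∈) (∈-map⁺ (V.lookup φ) x∈)

  nonLeaves : List (Fin N)
  nonLeaves = filterᵇ (λ v → not (deg T v ≡ᵇ 1)) (allFin N)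

  ∈-nonLeaves⁻ : ∀ {v} → v ∈ nonLeaves → deg T v ≢ 1
  ∈-nonLeaves⁻ {v} v∈ deg≡1 with () ← trans (sym (proj₂ (∈-filterᵇ⁻ _ {allFin N} v∈))) (cong (not ∘ (_≡ᵇ 1)) deg≡1)

  ∉y⇒nonLeaf : ∀ {φ x} → φ ∈ 𝓕 → V.lookup φ x ∉ y → x ∈ nonLeaves
  ∉y⇒nonLeaf {φ} {x} φ∈ ∉y with deg T x ≡ᵇ 1 in isLeaf
  ... | true  = ⊥-elim (∉y (leaf-image∈y φ∈ (∈-filterᵇ⁺ (λ v → deg T v ≡ᵇ 1) (∈-allFin x) isLeaf)))
  ... | false = ∈-filterᵇ⁺ (λ v → not (deg T v ≡ᵇ 1)) (∈-allFin x) (cong not isLeaf)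

  length-nonLeaves : length nonLeaves + numLeaves T ≡ suc t
  length-nonLeaves = trans (+-comm (length nonLeaves) (numLeaves T))
    (trans (length-filterᵇ-partition (λ v → deg T v ≡ᵇ 1) (allFin N)) (trans (length-tabulate _) size≡1+t))

  length-nonLeaves≤ : 2 ≤ numLeaves T → length nonLeaves ≤ t ∸ 1
  length-nonLeaves≤ 2≤p = ∸-monoˡ-≤ 1 (≤-pred (begin
    2 + length nonLeaves            ≡⟨ +-comm 2 (length nonLeaves) ⟩
    length nonLeaves + 2            ≤⟨ +-monoʳ-≤ (length nonLeaves) 2≤p ⟩
    length nonLeaves + numLeaves T  ≡⟨ length-nonLeaves ⟩
    suc t                           ∎))
    where open ≤-Reasoning

  someNonLeaf : numLeaves T ≤ t → ∃ λ i → i ∈ nonLeaves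
  someNonLeaf p≤t with nonLeaves | length-nonLeaves
  ... | i ∷ _ | _     = i , here refl
  ... | []    | p≡1+t = ⊥-elim (<-irrefl p≡1+t (s≤s p≤t))

  fibre : Fin N → Fin n → List (Map T n)
  fibre i w = filterᵇ (λ φ → V.lookup φ i == w) 𝓕

  ∈-fibre⁻ : ∀ {i w φ} → φ ∈ fibre i w → φ ∈ 𝓕 × V.lookup φ i ≡ w
  ∈-fibre⁻ {i} {w} φ∈ = map₂ ==⇒≡ (∈-filterᵇ⁻ (λ φ → V.lookup φ i == w) {𝓕} φ∈)

  admissible⇒light : ∀ {φ i u} → φ ∈ 𝓕 → deg T i ≢ 1 → adj T i u ≡ true → Light T h 𝓕 (split T i u) φ
  admissible⇒light φ∈ nonLeaf iu with All.lookup admissible φ∈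
  ... | inj₁ t≡1     = ⊥-elim (<-irrefl (sym t≡1) 2≤t)
  ... | inj₂ allLight = allLight _ nonLeaf _ iu

  SameRestr-isDecEquivalence : ∀ D → IsDecEquivalence (SameRestr T {n} D)
  SameRestr-isDecEquivalence D = record
    { isEquivalence = record
      { refl  = λ _ _ → refl
      ; sym   = λ φ~ψ w Dw → sym (φ~ψ w Dw)
      ; trans = λ φ~ψ ψ~χ w Dw → trans (φ~ψ w Dw) (ψ~χ w Dw)
      }
    ; _≟_ = λ φ ψ → all? λ w → (D w ≟ᵇ true) →-dec (V.lookup φ w ≟ᶠ V.lookup ψ w)
    }

  module _ {i : Fin N} {w : Fin n} (nonLeaf : deg T i ≢ 1) where

    private
      E : Fin N → ℕ
      E u = edgesIn (adj T) (split T i u)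

    fibre-sameLeafVec : ∀ {u φ ψ} → adj T i u ≡ true → φ ∈ fibre i w → ψ ∈ fibre i w → SameLeafVecIn T (split T i u) φ ψ
    fibre-sameLeafVec {u} {φ} {ψ} iu φ∈ ψ∈ = map-cong-local (All.tabulate agreeAt)
      where
      agreeAt : ∀ {x} → x ∈ leavesIn (adj T) (split T i u) → V.lookup φ x ≡ V.lookup ψ x
      agreeAt {x} x∈ with x ≟ᶠ i
      ... | yes refl = trans (proj₂ (∈-fibre⁻ φ∈)) (sym (proj₂ (∈-fibre⁻ ψ∈)))
      ... | no x≢i   = map-≡⇒≡ (leafVec T) (trans (All.lookup sameLeaves (proj₁ (∈-fibre⁻ φ∈)))
                                                  (sym (All.lookup sameLeaves (proj₁ (∈-fibre⁻ ψ∈)))))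
                                (split-leaf iu x≢i x∈)

    -- A longer list would witness that its head is heavy in 𝓕[split T i u].
    inequivalent-bound : ∀ {u} → u ∈ neighbours i → ∀ {K} → K ⊆ fibre i w →
                         AllPairs (λ φ ψ → ¬ SameRestr T (split T i u) φ ψ) K → length K ≤ h ^ (E u * E u) ∸ 1
    inequivalent-bound u∈ {[]} _ _ = z≤n
    inequivalent-bound {u} u∈ {φ ∷ K} K⊆ pairwise with h ^ (E u * E u) ≤? length (φ ∷ K)
    ... | no short = <⇒≤pred (≰⇒> short)
    ... | yes heavy = ⊥-elim (admissible⇒light (proj₁ (∈-fibre⁻ (K⊆ (here refl)))) nonLeaf (∈-neighbours⁻ u∈)
      (φ ∷ K , heavy , All.tabulate (proj₁ ∘ ∈-fibre⁻ ∘ K⊆) , pairwise ,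
       All.tabulate (fibre-sameLeafVec (∈-neighbours⁻ u∈) (K⊆ (here refl)) ∘ K⊆)))

    fibre-determined : ∀ {φ ψ} → φ ∈ fibre i w → ψ ∈ fibre i w →
                       (∀ {u} → u ∈ neighbours i → SameRestr T (split T i u) φ ψ) → φ ≡ ψ
    fibre-determined {φ} {ψ} φ∈ ψ∈ agree = lookup-extensionality agreeAt
      where
      agreeAt : ∀ x → V.lookup φ x ≡ V.lookup ψ x
      agreeAt x with x ≟ᶠ i
      ... | yes refl = trans (proj₂ (∈-fibre⁻ φ∈)) (sym (proj₂ (∈-fibre⁻ ψ∈)))
      ... | no x≢i with u , u∈ , x∈D ← split-cover x≢i = agree u∈ x x∈D

    fibre-bound : length (fibre i w) ≤ X ∸ 1
    fibre-bound = <⇒≤pred (begin-strict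
      length (fibre i w)
        ≤⟨ length≤product (λ u → SameRestr T (split T i u)) (λ u → SameRestr-isDecEquivalence (split T i u))
                          (neighbours i) (λ u → h ^ (E u * E u) ∸ 1) inequivalent-bound
                          (filter⁺ (T? ∘ λ φ → V.lookup φ i == w) unique) id fibre-determined ⟩
      product (map (λ u → h ^ (E u * E u) ∸ 1) (neighbours i))
        ≡⟨ cong product (map-∘ (neighbours i)) ⟩
      product (map (λ e → h ^ (e * e) ∸ 1) (map E (neighbours i)))
        <⟨ ∏pow∸1<pow h (map E (neighbours i)) t 2≤degree positive (∑-split-edges≤ i) ⟩
      X ∎)
      where
      open ≤-Reasoning
      2≤degree : 2 ≤ length (map E (neighbours i))
      2≤degree = subst (2 ≤_) (sym (length-map E (neighbours i)))
        (nonLeaf⇒2≤deg (proj₂ (anotherVertex (subst (2 ≤_) (sym size≡1+t) (m≤n⇒m≤1+n 2≤t)) i)) nonLeaf)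
      positive : All (0 <_) (map E (neighbours i))
      positive = All.map⁺ (All.tabulate (split-edges-pos ∘ ∈-neighbours⁻))

  Apart : Map T n → Map T n → Set
  Apart φ ψ = φ ≢ ψ × (∀ i j → V.lookup φ i ≡ V.lookup ψ j → V.lookup φ i ∈ y)

  apart? : Decidable Apart
  apart? φ ψ = ¬? (≡-dec _≟ᶠ_ φ ψ) ×-dec
               all? λ i → all? λ j → (V.lookup φ i ≟ᶠ V.lookup ψ j) →-dec (V.lookup φ i ∈? y)

  clash : ∀ {φ ψ} → ¬ Apart φ ψ → φ ≡ ψ ⊎ ∃ λ i → ∃ λ j → V.lookup φ i ≡ V.lookup ψ j × V.lookup φ i ∉ y
  clash {φ} {ψ} ¬apart with ≡-dec _≟ᶠ_ φ ψ
  ... | yes φ≡ψ = inj₁ φ≡ψ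
  ... | no φ≢ψ with any? (λ i → any? λ j → (V.lookup φ i ≟ᶠ V.lookup ψ j) ×-dec ¬? (V.lookup φ i ∈? y))
  ...   | yes (i , j , meet , ∉y) = inj₂ (i , j , meet , ∉y)
  ...   | no noClash = ⊥-elim (¬apart (φ≢ψ , λ i j meet →
                         decidable-stable (V.lookup φ i ∈? y) λ ∉y → noClash (i , j , meet , ∉y)))

  open Maximal (maximal-AllPairs apart? 𝓕) public

  members-linked : h ≤ length members → Linked T h 𝓕 y
  members-linked h≤ = take h members , trans (length-take h members) (m≤n⇒m⊓n≡m h≤) ,
    All.take⁺ h (All.tabulate members⊆) , All.take⁺ h (All.tabulate (All.lookup sameLeaves ∘ members⊆)) ,
    AllPairs.take⁺ h pairwise

  meetings : List (Map T n × Fin N × Fin N)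
  meetings = cartesianProduct members (cartesianProduct nonLeaves nonLeaves)

  meets : Map T n × Fin N × Fin N → Map T n → Bool
  meets (ψ , i , j) φ = V.lookup φ i == V.lookup ψ j

  meeting-nonLeaf : ∀ {ψ i j} → (ψ , i , j) ∈ meetings → i ∈ nonLeaves
  meeting-nonLeaf r∈ = proj₁ (∈-cartesianProduct⁻ nonLeaves nonLeaves (proj₂ (∈-cartesianProduct⁻ members _ r∈)))

  length-meetings : length members < h → 2 ≤ numLeaves T → length meetings ≤ (h ∸ 1) * ((t ∸ 1) * (t ∸ 1))
  length-meetings |M|<h 2≤p = begin
    length meetings                                               ≡⟨ length-cartesianProduct members _ ⟩
    length members * length (cartesianProduct nonLeaves nonLeaves)
      ≡⟨ cong (length members *_) (length-cartesianProduct nonLeaves nonLeaves) ⟩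
    length members * (length nonLeaves * length nonLeaves)
      ≤⟨ *-mono-≤ (<⇒≤pred |M|<h) (*-mono-≤ |NL|≤t∸1 |NL|≤t∸1) ⟩
    (h ∸ 1) * ((t ∸ 1) * (t ∸ 1))                                ∎
    where
    open ≤-Reasoning
    |NL|≤t∸1 = length-nonLeaves≤ 2≤p

  member-meets-itself : numLeaves T ≤ t → ∀ {φ} → φ ∈ members → ∃ λ r → r ∈ meetings × meets r φ ≡ true
  member-meets-itself p≤t {φ} φ∈M with i , i∈ ← someNonLeaf p≤t =
    (φ , i , i) , ∈-cartesianProduct⁺ φ∈M (∈-cartesianProduct⁺ i∈ i∈) , ==-refl (V.lookup φ i)

  meetings-cover : numLeaves T ≤ t → ∀ {φ} → φ ∈ 𝓕 → ∃ λ r → r ∈ meetings × meets r φ ≡ true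
  meetings-cover p≤t {φ} φ∈ with maximal φ∈
  ... | inj₁ φ∈M = member-meets-itself p≤t φ∈M
  ... | inj₂ (ψ , ψ∈M , ¬apart) with clash ¬apart
  ...   | inj₁ refl = member-meets-itself p≤t ψ∈M
  ...   | inj₂ (i , j , meet , ∉y) =
    (ψ , i , j) ,
    ∈-cartesianProduct⁺ ψ∈M (∈-cartesianProduct⁺ (∉y⇒nonLeaf φ∈ ∉y)
                                                 (∉y⇒nonLeaf (members⊆ ψ∈M) (subst (_∉ y) meet ∉y))) ,
    subst (λ z → (V.lookup φ i == z) ≡ true) meet (==-refl (V.lookup φ i))

  few-members⇒few : length members < h → 2 ≤ numLeaves T → numLeaves T ≤ t →
                    length 𝓕 ≤ (h ∸ 1) * ((t ∸ 1) * (t ∸ 1)) * (X ∸ 1)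
  few-members⇒few |M|<h 2≤p p≤t = begin
    length 𝓕                                         ≤⟨ cover⇒length≤∑ meets meetings 𝓕 (meetings-cover p≤t) ⟩
    ∑ meetings (λ r → length (filterᵇ (meets r) 𝓕))  ≤⟨ ∑-≤-* meetings (fibre-bound ∘ ∈-nonLeaves⁻ ∘ meeting-nonLeaf) ⟩
    length meetings * (X ∸ 1)                        ≤⟨ *-monoˡ-≤ (X ∸ 1) (length-meetings |M|<h 2≤p) ⟩
    (h ∸ 1) * ((t ∸ 1) * (t ∸ 1)) * (X ∸ 1)          ∎
    where open ≤-Reasoning

lemma3p4 : {n : ℕ} (G : Graph n) (h t p : ℕ) → t ≥ p → p ≥ 2 → h ≥ t →
    (T : LTree) → e T ≡ t → numLeaves T ≡ p →
    (𝓕 : List (Map T n)) → Unique 𝓕 → All (IsCopy T G) 𝓕 →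
    All (Admissible T h 𝓕) 𝓕 →
    (y : List (Fin n)) → All (λ φ → leafVecOf T φ ≡ y) 𝓕 →
    h ^ (t * t) ≤ 2 * length 𝓕 →
    Linked T h 𝓕 y
lemma3p4 G h t p t≥p p≥2 h≥t T refl refl 𝓕 unique _ admissible y sameLeaves big =
  case h ≤? length members of λ
    { (yes enough) → members-linked enough
    ; (no short)   → ⊥-elim (<⇒≱ (doubled-count<h^t² h t 2≤h 2≤t)
                                  (≤-trans big (*-monoʳ-≤ 2 (few-members⇒few (≰⇒> short) p≥2 t≥p))))
    }
  where
  2≤t = ≤-trans p≥2 t≥p
  2≤h = ≤-trans 2≤t h≥t
  instance
    h≢0 : NonZero h
    h≢0 = >-nonZero (≤-trans (s≤s z≤n) 2≤h)
  open Linking T h 𝓕 unique admissible y sameLeaves 2≤t
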